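{- For every positive integer $n$, every even-sunflower-free family $\mathcal{F}\subseteq 2^{\{1,\dots,n\}}$ satisfies $|\mathcal{F}|\le n$. Consequently, $f_{even}(n)=n$, where $f_{even}(n)$ denotes the maximum size of an even-sunflower-free family of subsets of $\{1,\dots,n\}$.
   Context: A nonempty family of nonempty sets is an even-sunflower if every element of the underlying set is contained in an even number of sets of the family (or in none). A family is even-sunflower-free if no subfamily of it is an even-sunflower. -}

module Defs where

open import Data.Nat using (ℕ; _≤_)
open import Data.Nat.Divisibility using (_∣_)
open import Data.Fin using (Fin)
open import Data.Fin.Subset using (Subset; _∈_; _∩_; ∣_∣; Nonempty)
open import Data.Vec using (lookup; tabulate)
open import Data.Product using (_×_)
open import Relation.Nullary using (¬_)

-- A family of m subsets of {1,…,n} (modelled as Fin n), indexed by Fin m.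
-- Distinctness of the members (so that the family is a set of size m)
-- is imposed separately via injectivity.
Family : ℕ → ℕ → Set
Family m n = Fin m → Subset n

incidence : ∀ {m n} → Family m n → Fin n → Subset m
incidence F x = tabulate (λ j → lookup (F j) x)

IsEvenSunflower : ∀ {m n} → Family m n → Subset m → Set
IsEvenSunflower F S =
  Nonempty S × (∀ j → j ∈ S → Nonempty (F j)) × (∀ x → 2 ∣ ∣ S ∩ incidence F x ∣)

EvenSunflowerFree : ∀ {m n} → Family m n → Set
EvenSunflowerFree {m} F = ∀ (S : Subset m) → ¬ IsEvenSunflower F S

-- Index the subfamilies by the subsets S of {1,…,m} and send S to the set of points lying in an
-- odd number of the F j with j ∈ S (the sum of their incidence vectors over GF(2)).  When m > n
-- there are more subfamilies than such sets, so two distinct S ≠ T collide, and then the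
-- symmetric difference S ⊕ T is an even-sunflower.  The n singletons show that the bound is attained: a point x of a subfamily
-- of singletons lies in exactly one of its members.
module Submission where

open import Defs
import Data.Nat as ℕ
open import Data.Nat using (ℕ; _≤_; _>_; _<_; _^_; s≤s; z≤n)
open import Data.Nat.Properties using (≮⇒≥; ^-monoʳ-<; ≤-antisym; ≤-trans; ≤-reflexive)
open import Data.Nat.Divisibility using (_∣_; _∣0; ∣-refl; ∣m∣n⇒∣m+n; ∣1⇒≡1)
open import Data.Fin using (Fin; zero; suc; finToFun; funToFin; combine)
open import Data.Fin.Properties using (pigeonhole; <⇒≢; 2↔Bool; finToFun-funToFin; funToFin-finToFin)
open import Data.Fin.Subset using (Subset; _∈_; _∩_; ∣_∣; ⁅_⁆; Nonempty; inside; outside)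
open import Data.Fin.Subset.Properties
  using (x∈⁅x⁆; x∈⁅y⁆⇒x≡y; ∣⁅x⁆∣≡1; p⊆q⇒∣p∣≤∣q∣; p∩q⊆q; x∈p∩q⁺)
open import Data.Bool using (Bool; true; false; _xor_; _∧_)
open import Data.Bool.Properties using (not-injective; xor-same; ∧-distribʳ-xor; xor-∧-commutativeRing)
open import Data.Vec using ([]; _∷_; lookup; tabulate; zipWith; here; there)
open import Data.Vec.Properties using (lookup∘tabulate; tabulate∘lookup; tabulate-cong; lookup-replicate)
open import Data.Product using (_×_; Σ; _,_; ∃₂)
import Data.Product as Product
open import Algebra.Bundles using (CommutativeRing)
open import Algebra.Properties.CommutativeSemigroup
  (CommutativeRing.+-commutativeSemigroup xor-∧-commutativeRing) using (interchange)
open import Function using (_∘_; _↔_; Inverse; mk↔ₛ′; Injection)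
open import Function.Definitions using (Injective)
open import Function.Properties.Inverse using (↔⇒↣; ↔-sym)
open import Relation.Nullary using (contradiction)
open import Relation.Binary.PropositionalEquality
  using (_≡_; _≢_; _≗_; refl; sym; trans; cong; cong₂; subst; module ≡-Reasoning)

private
  variable
    a b m n : ℕ
    A B : Set

pigeonhole-↔ : b < a → A ↔ Fin a → B ↔ Fin b → (f : A → B) → ∃₂ λ x y → x ≢ y × f x ≡ f y
pigeonhole-↔ b<a A↔a B↔b f
  with i , j , i<j , eq ← pigeonhole b<a (Inverse.to B↔b ∘ f ∘ Inverse.from A↔a)
  = from i , from j , <⇒≢ i<j ∘ Injection.injective (↔⇒↣ (↔-sym A↔a))
  , Injection.injective (↔⇒↣ B↔b) eq
  where open Inverse A↔a using (from)

funToFin-cong : {f g : Fin m → Fin n} → f ≗ g → funToFin f ≡ funToFin g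
funToFin-cong {ℕ.zero}  f≗g = refl
funToFin-cong {ℕ.suc m} f≗g = cong₂ combine (f≗g zero) (funToFin-cong (f≗g ∘ suc))

Subset↔Fin : Subset n ↔ Fin (2 ^ n)
Subset↔Fin {n} = mk↔ₛ′ toFin fromFin toFin∘fromFin fromFin∘toFin
  where
  open Inverse 2↔Bool using (to; from; strictlyInverseˡ; strictlyInverseʳ)

  toFin : Subset n → Fin (2 ^ n)
  toFin p = funToFin {n} (from ∘ lookup p)

  fromFin : Fin (2 ^ n) → Subset n
  fromFin i = tabulate (to ∘ finToFun {2} i)

  toFin∘fromFin : (i : Fin (2 ^ n)) → toFin (fromFin i) ≡ i
  toFin∘fromFin i = trans
    (funToFin-cong {n} λ x → trans (cong from (lookup∘tabulate (to ∘ finToFun i) x)) (strictlyInverseʳ _))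
    (funToFin-finToFin {n} i)

  fromFin∘toFin : (p : Subset n) → fromFin (toFin p) ≡ p
  fromFin∘toFin p = trans
    (tabulate-cong λ x → trans (cong to (finToFun-funToFin _ x)) (strictlyInverseˡ _))
    (tabulate∘lookup p)

subset-pigeonhole : n < m → (f : Subset m → Subset n) → ∃₂ λ p q → p ≢ q × f p ≡ f q
subset-pigeonhole n<m = pigeonhole-↔ (^-monoʳ-< 2 (s≤s (s≤s z≤n)) n<m) Subset↔Fin Subset↔Fin

infixl 6 _⊕_

_⊕_ : Subset n → Subset n → Subset n
_⊕_ = zipWith _xor_

⊕-nonempty : (p q : Subset n) → p ≢ q → Nonempty (p ⊕ q)
⊕-nonempty []            []            p≢q = contradiction refl p≢q
⊕-nonempty (inside ∷ p)  (outside ∷ q) _   = zero , here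
⊕-nonempty (outside ∷ p) (inside ∷ q)  _   = zero , here
⊕-nonempty (inside ∷ p)  (inside ∷ q)  p≢q =
  Product.map suc there (⊕-nonempty p q (p≢q ∘ cong (inside ∷_)))
⊕-nonempty (outside ∷ p) (outside ∷ q) p≢q =
  Product.map suc there (⊕-nonempty p q (p≢q ∘ cong (outside ∷_)))

parity : Subset n → Bool
parity []      = false
parity (x ∷ p) = x xor parity p

parity-⊕-∩ : (p q r : Subset n) → parity ((p ⊕ q) ∩ r) ≡ parity (p ∩ r) xor parity (q ∩ r)
parity-⊕-∩ []      []      []      = refl
parity-⊕-∩ (x ∷ p) (y ∷ q) (z ∷ r) = begin
  (x xor y) ∧ z xor parity ((p ⊕ q) ∩ r)
    ≡⟨ cong₂ _xor_ (∧-distribʳ-xor z x y) (parity-⊕-∩ p q r) ⟩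
  (x ∧ z xor y ∧ z) xor (parity (p ∩ r) xor parity (q ∩ r))
    ≡⟨ interchange (x ∧ z) (y ∧ z) (parity (p ∩ r)) (parity (q ∩ r)) ⟩
  (x ∧ z xor parity (p ∩ r)) xor (y ∧ z xor parity (q ∩ r))
    ∎
  where open ≡-Reasoning

mutual
  parity≡false⇒even : (p : Subset n) → parity p ≡ false → 2 ∣ ∣ p ∣
  parity≡false⇒even []            _ = 2 ∣0
  parity≡false⇒even (outside ∷ p) e = parity≡false⇒even p e
  parity≡false⇒even (inside ∷ p)  e = parity≡true⇒odd p (not-injective e)

  parity≡true⇒odd : (p : Subset n) → parity p ≡ true → 2 ∣ ℕ.suc (∣ p ∣)
  parity≡true⇒odd (outside ∷ p) e = parity≡true⇒odd p e
  parity≡true⇒odd (inside ∷ p)  e = ∣m∣n⇒∣m+n ∣-refl (parity≡false⇒even p (not-injective e))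

oddPoints : Family m n → Subset m → Subset n
oddPoints F S = tabulate λ x → parity (S ∩ incidence F x)

oddPoints-collision⇒evenSunflower : (F : Family m n) → (∀ j → Nonempty (F j)) →
  {S T : Subset m} → S ≢ T → oddPoints F S ≡ oddPoints F T → IsEvenSunflower F (S ⊕ T)
oddPoints-collision⇒evenSunflower F nonempty {S} {T} S≢T same =
  ⊕-nonempty S T S≢T , (λ j _ → nonempty j) , λ x → parity≡false⇒even ((S ⊕ T) ∩ I x) (evenAt x)
  where
  open ≡-Reasoning
  I = incidence F

  sameAt : ∀ x → parity (S ∩ I x) ≡ parity (T ∩ I x)
  sameAt x = begin
    parity (S ∩ I x)          ≡⟨ lookup∘tabulate (λ y → parity (S ∩ I y)) x ⟨
    lookup (oddPoints F S) x  ≡⟨ cong (λ v → lookup v x) same ⟩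
    lookup (oddPoints F T) x  ≡⟨ lookup∘tabulate (λ y → parity (T ∩ I y)) x ⟩
    parity (T ∩ I x)          ∎

  evenAt : ∀ x → parity ((S ⊕ T) ∩ I x) ≡ false
  evenAt x = begin
    parity ((S ⊕ T) ∩ I x)                 ≡⟨ parity-⊕-∩ S T (I x) ⟩
    parity (S ∩ I x) xor parity (T ∩ I x)  ≡⟨ cong (_xor parity (T ∩ I x)) (sameAt x) ⟩
    parity (T ∩ I x) xor parity (T ∩ I x)  ≡⟨ xor-same (parity (T ∩ I x)) ⟩
    false                                  ∎

evenSunflowerFree⇒≤ : (F : Family m n) → (∀ j → Nonempty (F j)) → EvenSunflowerFree F → m ≤ n
evenSunflowerFree⇒≤ F nonempty free = ≮⇒≥ λ n<m →
  let S , T , S≢T , same = subset-pigeonhole n<m (oddPoints F)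
  in free (S ⊕ T) (oddPoints-collision⇒evenSunflower F nonempty S≢T same)

lookup-⁅⁆-comm : (i j : Fin n) → lookup ⁅ i ⁆ j ≡ lookup ⁅ j ⁆ i
lookup-⁅⁆-comm zero    zero    = refl
lookup-⁅⁆-comm zero    (suc j) = lookup-replicate j outside
lookup-⁅⁆-comm (suc i) zero    = sym (lookup-replicate i outside)
lookup-⁅⁆-comm (suc i) (suc j) = lookup-⁅⁆-comm i j

incidence-⁅⁆ : (x : Fin n) → incidence ⁅_⁆ x ≡ ⁅ x ⁆
incidence-⁅⁆ x = trans (tabulate-cong λ j → lookup-⁅⁆-comm j x) (tabulate∘lookup ⁅ x ⁆)

x∈p⇒∣p∩⁅x⁆∣≡1 : {x : Fin n} (p : Subset n) → x ∈ p → ∣ p ∩ ⁅ x ⁆ ∣ ≡ 1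
x∈p⇒∣p∩⁅x⁆∣≡1 {x = x} p x∈p = ≤-antisym
  (≤-trans (p⊆q⇒∣p∣≤∣q∣ (p∩q⊆q p ⁅ x ⁆)) (≤-reflexive (∣⁅x⁆∣≡1 x)))
  (subst (_≤ ∣ p ∩ ⁅ x ⁆ ∣) (∣⁅x⁆∣≡1 x) (p⊆q⇒∣p∣≤∣q∣ ⁅x⁆⊆p∩⁅x⁆))
  where
  ⁅x⁆⊆p∩⁅x⁆ : ∀ {y} → y ∈ ⁅ x ⁆ → y ∈ p ∩ ⁅ x ⁆
  ⁅x⁆⊆p∩⁅x⁆ y∈⁅x⁆ = subst (_∈ p ∩ ⁅ x ⁆) (sym (x∈⁅y⁆⇒x≡y x y∈⁅x⁆)) (x∈p∩q⁺ (x∈p , x∈⁅x⁆ x))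

⁅⁆-injective : Injective _≡_ _≡_ (⁅_⁆ {n})
⁅⁆-injective {x = i} {y = j} ⁅i⁆≡⁅j⁆ = x∈⁅y⁆⇒x≡y j (subst (i ∈_) ⁅i⁆≡⁅j⁆ (x∈⁅x⁆ i))

⁅⁆-evenSunflowerFree : EvenSunflowerFree (⁅_⁆ {n})
⁅⁆-evenSunflowerFree S ((x , x∈S) , _ , even) = contradiction (∣1⇒≡1 2∣1) λ ()
  where
  2∣1 : 2 ∣ 1
  2∣1 = subst (2 ∣_) (trans (cong (∣_∣ ∘ (S ∩_)) (incidence-⁅⁆ x)) (x∈p⇒∣p∩⁅x⁆∣≡1 S x∈S)) (even x)

theorem1 : (n : ℕ) → n > 0 →
    ((m : ℕ) (F : Family m n) → Injective _≡_ _≡_ F → (∀ j → Nonempty (F j)) →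
      EvenSunflowerFree F → m ≤ n)
    × Σ (Family n n) (λ F → Injective _≡_ _≡_ F × (∀ j → Nonempty (F j)) × EvenSunflowerFree F)
theorem1 n _ =
  (λ m F _ → evenSunflowerFree⇒≤ F)
  , ⁅_⁆ , ⁅⁆-injective , (λ j → j , x∈⁅x⁆ j) , ⁅⁆-evenSunflowerFree
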